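{- Let $n$ be a positive integer and $\lambda$ a positive integer. If $Q_n$ (the $4\times n$ grid with one sticky end) admits a $\lambda$-ranking and $P_{n-1}$ (the $4\times(n-1)$ grid with two sticky ends) admits a $\lambda$-ranking, then $Q_{2n+3}$ admits a $(\lambda+4)$-ranking and the grid graph $G_{4,4n+10}$ admits a $(\lambda+8)$-ranking.
   Context: A $k$-ranking of a graph $G$ is a labeling $f:V(G)\to\{1,\dots,k\}$ such that every path between two distinct vertices with the same label contains a vertex with a larger label. $G_{m,n}$ is the $m\times n$ grid graph. All graphs are induced subgraphs of the infinite grid on $\mathbb{Z}^2$ (vertices $(i,j)$, adjacent iff they agree in one coordinate and differ by $1$ in the other), $i$ being the row index. The $4\times n$ grid with one sticky end is $Q_n$, induced on $\{(i,j):1\le i\le 4,\ 1\le j\le n+i-1\}$ (the $4\times n$ grid with a staircase of $0,1,2,3$ extra vertices appended to the right of rows $1,2,3,4$). The $4\times n$ grid with two sticky ends is $P_n$, induced on $\{(i,j):1\le i\le 4,\ i-3\le j\le n+i-1\}$ (additionally a staircase of $3,2,1,0$ vertices appended on the left of rows $1,\dots,4$). -}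

module Defs where

open import Data.Nat as ℕ using (ℕ)
open import Data.Integer as ℤ using (ℤ; +_; _+_; _-_; ∣_∣)
open import Data.Product using (_×_; Σ; ∃; _,_)
open import Data.Sum using (_⊎_)
open import Data.List using (List; []; _∷_)
open import Data.List.Relation.Unary.Any using (Any)
open import Data.List.Relation.Unary.Unique.Propositional using (Unique)
open import Relation.Binary.PropositionalEquality using (_≡_)
open import Relation.Nullary using (¬_)

-- Vertices of the infinite grid Z^2: (row i , column j)
Vertex : Set
Vertex = ℤ × ℤ

Adj : Vertex → Vertex → Set
Adj (i , j) (i' , j') = (i ≡ i' × ∣ j - j' ∣ ≡ 1) ⊎ (j ≡ j' × ∣ i - i' ∣ ≡ 1)

-- An induced subgraph of the infinite grid is given by its vertex set
VSet : Set₁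
VSet = Vertex → Set

data Walk (G : VSet) : Vertex → Vertex → List Vertex → Set where
  here  : ∀ {u} → G u → Walk G u u (u ∷ [])
  there : ∀ {u w v p} → G u → Adj u w → Walk G w v p → Walk G u v (u ∷ p)

IsPath : VSet → Vertex → Vertex → List Vertex → Set
IsPath G u v p = Walk G u v p × Unique p

IsRanking : VSet → ℕ → (Vertex → ℕ) → Set
IsRanking G k f =
  (∀ v → G v → 1 ℕ.≤ f v × f v ℕ.≤ k) ×
  (∀ u v p → u ≢ v → f u ≡ f v → IsPath G u v p → Any (λ w → f u ℕ.< f w) p)
  where
    _≢_ : Vertex → Vertex → Set
    a ≢ b = ¬ (a ≡ b)

HasRanking : VSet → ℕ → Set
HasRanking G k = Σ (Vertex → ℕ) (IsRanking G k)

Grid : ℕ → ℕ → VSet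
Grid m n (i , j) = (+ 1 ℤ.≤ i × i ℤ.≤ + m) × (+ 1 ℤ.≤ j × j ℤ.≤ + n)

Q : ℕ → VSet
Q n (i , j) = (+ 1 ℤ.≤ i × i ℤ.≤ + 4) × (+ 1 ℤ.≤ j × j ℤ.≤ (+ n + i) - + 1)

P : ℕ → VSet
P n (i , j) = (+ 1 ℤ.≤ i × i ℤ.≤ + 4) × (i - + 3 ℤ.≤ j × j ℤ.≤ (+ n + i) - + 1)

-- Cut the strip of rows 1–4 along the staircase {(i , c + i)}: the part left of it is Q_c,
-- and there are no edges between the parts left and right of it. Keeping given λ-rankings
-- on both parts and labelling the four staircase vertices λ + 1, …, λ + 4 gives a
-- (λ + 4)-ranking: a path between two equal labels either stays inside one part, or
-- crosses the staircase and meets a larger label there. For Q_{2n+3} (c = n) the right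
-- part is a translate of P_{n-1}; for G_{4,2c+4} it is the half-turn image of Q_c.
-- Applying the second cut with c = 2n + 3 to the first result gives G_{4,4n+10}.
module Submission where

open import Defs
open import Data.Nat using (ℕ; zero; suc; _+_; _*_; _∸_; _≤_; _<_; s≤s; z≤n)
open import Data.Nat.Properties
  using (<-cmp; ≤-trans; ≤-<-trans; <⇒≤; <⇒≱; n≤1+n; ≤-pred; m≤m+n; m<m+n;
         +-comm; +-assoc; +-suc; +-monoʳ-≤; +-monoˡ-≤; +-cancelˡ-≡; module ≤-Reasoning)
open import Data.Integer as ℤ using (ℤ; +_; +≤+; ∣_∣)
import Data.Integer.Properties as ℤ
open import Data.Product using (Σ; _×_; _,_; proj₁; proj₂; map₂)
open import Data.Sum as Sum using (_⊎_; inj₁; inj₂)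
open import Data.Empty using (⊥-elim)
open import Data.List using ([]; _∷_; map)
open import Data.List.Relation.Unary.Any as Any using (Any)
import Data.List.Relation.Unary.Any.Properties as AnyP
import Data.List.Relation.Unary.Unique.Propositional.Properties as Unique
open import Function using (id; _∘_)
open import Function.Definitions using (Injective)
open import Relation.Binary using (tri<; tri≈; tri>)
open import Relation.Binary.PropositionalEquality
open import Relation.Nullary using (¬_)
open import Relation.Unary using (_⊆_; _∩_; _∪_)
import Data.Integer.Tactic.RingSolver as ℤ-Solver
import Data.Nat.Tactic.RingSolver as ℕ-Solver

RankingCondition : VSet → (Vertex → ℕ) → Set
RankingCondition G f =
  ∀ u v p → ¬ u ≡ v → f u ≡ f v → IsPath G u v p → Any (λ w → f u < f w) p

source : ∀ {G u v p} → Walk G u v p → G u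
source (here Gu)      = Gu
source (there Gu _ _) = Gu

target : ∀ {G u v p} → Walk G u v p → G v
target (here Gv)        = Gv
target (there _ _ rest) = target rest

any-source : ∀ {G u v p} {S : VSet} → Walk G u v p → S u → Any S p
any-source (here _)      Su = Any.here Su
any-source (there _ _ _) Su = Any.here Su

any-map-along : ∀ {G u v p} {P R : VSet} →
  (∀ {x} → G x → P x → R x) → Walk G u v p → Any P p → Any R p
any-map-along h (here Gx)        (Any.here Px) = Any.here (h Gx Px)
any-map-along h (there Gx _ _)   (Any.here Px) = Any.here (h Gx Px)
any-map-along h (there _ _ rest) (Any.there a) = Any.there (any-map-along h rest a)

adj-sym : ∀ {u v} → Adj u v → Adj v u
adj-sym {i , j} {i' , j'} (inj₁ (i≡i' , d)) = inj₁ (sym i≡i' , trans (ℤ.∣i-j∣≡∣j-i∣ j' j) d)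
adj-sym {i , j} {i' , j'} (inj₂ (j≡j' , d)) = inj₂ (sym j≡j' , trans (ℤ.∣i-j∣≡∣j-i∣ i' i) d)

walk-meets-or-stays : ∀ {G X S Y : VSet} → G ⊆ X ∪ (S ∪ Y) → (∀ {u v} → X u → Y v → ¬ Adj u v) →
  ∀ {u v p} → X u → Walk G u v p → Any S p ⊎ Walk (G ∩ X) u v p
walk-meets-or-stays split apart Xu (here Gu) = inj₂ (here (Gu , Xu))
walk-meets-or-stays split apart Xu (there Gu u~w rest) with split (source rest)
... | inj₁ Xw =
  Sum.map Any.there (there (Gu , Xu) u~w) (walk-meets-or-stays split apart Xw rest)
... | inj₂ (inj₁ Sw) = inj₁ (Any.there (any-source rest Sw))
... | inj₂ (inj₂ Yw) = ⊥-elim (apart Xu Yw u~w)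

separator-ranking : ∀ {G A S B : VSet} {f : Vertex → ℕ} {μ k : ℕ} →
  G ⊆ A ∪ (S ∪ B) → (∀ {u v} → A u → B v → ¬ Adj u v) →
  IsRanking (G ∩ A) μ f → IsRanking (G ∩ B) μ f →
  (∀ {v} → S v → μ < f v × f v ≤ k) → (∀ {u v} → S u → S v → f u ≡ f v → u ≡ v) →
  μ ≤ k → IsRanking G k f
separator-ranking {G} {A} {S} {B} {f} {μ} {k}
  split apart (bounds-A , ranked-A) (bounds-B , ranked-B) label-S injective-S μ≤k = bounds , ranked
  where
  split-mirrored : G ⊆ B ∪ (S ∪ A)
  split-mirrored Gv = Sum.[ inj₂ ∘ inj₂ , Sum.[ inj₂ ∘ inj₁ , inj₁ ] ] (split Gv)

  apart-mirrored : ∀ {u v} → B u → A v → ¬ Adj u v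
  apart-mirrored Bu Av = apart Av Bu ∘ adj-sym

  S-above : ∀ {u v} → S u → f u ≡ f v → ¬ f v ≤ μ
  S-above Su fu≡fv = <⇒≱ (subst (μ <_) fu≡fv (proj₁ (label-S Su)))

  larger-on-S : ∀ {u p} → f u ≤ μ → Any S p → Any (λ w → f u < f w) p
  larger-on-S fu≤μ = Any.map (λ Sw → ≤-<-trans fu≤μ (proj₁ (label-S Sw)))

  bounds : ∀ v → G v → 1 ≤ f v × f v ≤ k
  bounds v Gv with split Gv
  ... | inj₁ Av         = map₂ (λ le → ≤-trans le μ≤k) (bounds-A v (Gv , Av))
  ... | inj₂ (inj₁ Sv) = ≤-trans (s≤s z≤n) (proj₁ (label-S Sv)) , proj₂ (label-S Sv)
  ... | inj₂ (inj₂ Bv) = map₂ (λ le → ≤-trans le μ≤k) (bounds-B v (Gv , Bv))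

  ranked : RankingCondition G f
  ranked u v p u≢v fu≡fv (walk , unique) with split (source walk)
  ... | inj₁ Au = Sum.[ larger-on-S (proj₂ (bounds-A u (source walk , Au)))
                      , (λ walk-A → ranked-A u v p u≢v fu≡fv (walk-A , unique)) ]
                      (walk-meets-or-stays split apart Au walk)
  ... | inj₂ (inj₂ Bu) = Sum.[ larger-on-S (proj₂ (bounds-B u (source walk , Bu)))
                             , (λ walk-B → ranked-B u v p u≢v fu≡fv (walk-B , unique)) ]
                             (walk-meets-or-stays split-mirrored apart-mirrored Bu walk)
  ... | inj₂ (inj₁ Su) with split (target walk)
  ...   | inj₁ Av         = ⊥-elim (S-above Su fu≡fv (proj₂ (bounds-A v (target walk , Av))))
  ...   | inj₂ (inj₁ Sv) = ⊥-elim (u≢v (injective-S Su Sv fu≡fv))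
  ...   | inj₂ (inj₂ Bv) = ⊥-elim (S-above Su fu≡fv (proj₂ (bounds-B v (target walk , Bv))))

Isometry : (ℤ → ℤ) → Set
Isometry α = ∀ x y → ∣ α x ℤ.- α y ∣ ≡ ∣ x ℤ.- y ∣

isometry-injective : ∀ {α} → Isometry α → Injective _≡_ _≡_ α
isometry-injective {α} iso {x} {y} αx≡αy = ℤ.i-j≡0⇒i≡j x y (ℤ.∣i∣≡0⇒i≡0 (begin
  ∣ x ℤ.- y ∣     ≡⟨ sym (iso x y) ⟩
  ∣ α x ℤ.- α y ∣ ≡⟨ cong (λ z → ∣ z ℤ.- α y ∣) αx≡αy ⟩
  ∣ α y ℤ.- α y ∣ ≡⟨ cong ∣_∣ (ℤ.+-inverseʳ (α y)) ⟩
  0               ∎))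
  where open ≡-Reasoning

translation-isometry : ∀ d → Isometry (ℤ._- d)
translation-isometry d x y = cong ∣_∣ (cancel x y d)
  where
  cancel : ∀ x y d → (x ℤ.- d) ℤ.- (y ℤ.- d) ≡ x ℤ.- y
  cancel = ℤ-Solver.solve-∀

reflection-isometry : ∀ c → Isometry (λ x → c ℤ.- x)
reflection-isometry c x y = trans (cong ∣_∣ (cancel c x y)) (ℤ.∣-i∣≡∣i∣ (x ℤ.- y))
  where
  cancel : ∀ c x y → (c ℤ.- x) ℤ.- (c ℤ.- y) ≡ ℤ.- (x ℤ.- y)
  cancel = ℤ-Solver.solve-∀

record GridEmbedding : Set where
  field
    to        : Vertex → Vertex
    adj       : ∀ {u v} → Adj u v → Adj (to u) (to v)
    injective : Injective _≡_ _≡_ to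

open GridEmbedding

identity-embedding : GridEmbedding
identity-embedding = record { to = id ; adj = id ; injective = id }

product-embedding : ∀ {α β} → Isometry α → Isometry β → GridEmbedding
product-embedding {α} {β} iso-α iso-β = record
  { to        = λ (i , j) → α i , β j
  ; adj       = adj′
  ; injective = λ eq → cong₂ _,_ (isometry-injective iso-α (cong proj₁ eq))
                                 (isometry-injective iso-β (cong proj₂ eq))
  }
  where
  adj′ : ∀ {u v} → Adj u v → Adj (α (proj₁ u) , β (proj₂ u)) (α (proj₁ v) , β (proj₂ v))
  adj′ {i , j} {i' , j'} (inj₁ (i≡i' , d)) = inj₁ (cong α i≡i' , trans (iso-β j j') d)
  adj′ {i , j} {i' , j'} (inj₂ (j≡j' , d)) = inj₂ (cong β j≡j' , trans (iso-α i i') d)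

shift-columns : ℤ → GridEmbedding
shift-columns d = product-embedding {α = id} {β = ℤ._- d} (λ _ _ → refl) (translation-isometry d)

half-turn : ℤ → ℤ → GridEmbedding
half-turn x y = product-embedding {α = λ i → x ℤ.- i} {β = λ j → y ℤ.- j}
  (reflection-isometry x) (reflection-isometry y)

isRanking-pullback : ∀ {B H : VSet} {k : ℕ} {f g : Vertex → ℕ} (φ : GridEmbedding) →
  B ⊆ H ∘ to φ → (∀ {v} → B v → f v ≡ g (to φ v)) → IsRanking H k g → IsRanking B k f
isRanking-pullback {B} {H} {k} {f} {g} φ B⊆H f≡g∘φ (bounds-H , ranked-H) = bounds , ranked
  where
  bounds : ∀ v → B v → 1 ≤ f v × f v ≤ k
  bounds v Bv = subst (λ x → 1 ≤ x × x ≤ k) (sym (f≡g∘φ Bv)) (bounds-H (to φ v) (B⊆H Bv))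

  walk-image : ∀ {x y q} → Walk B x y q → Walk H (to φ x) (to φ y) (map (to φ) q)
  walk-image (here Bx)           = here (B⊆H Bx)
  walk-image (there Bx x~y rest) = there (B⊆H Bx) (adj φ x~y) (walk-image rest)

  ranked : RankingCondition B f
  ranked u v p u≢v fu≡fv (walk , unique) =
    any-map-along (λ Bw → subst₂ _<_ (sym (f≡g∘φ (source walk))) (sym (f≡g∘φ Bw))) walk
      (AnyP.map⁻ (ranked-H (to φ u) (to φ v) (map (to φ) p) (u≢v ∘ injective φ)
        (trans (sym (f≡g∘φ (source walk))) (trans fu≡fv (f≡g∘φ (target walk))))
        (walk-image walk , Unique.map⁺ (injective φ) unique)))

∣m⊖n∣≡1⇒m≡1+n⊎n≡1+m : ∀ m n → ∣ m ℤ.⊖ n ∣ ≡ 1 → m ≡ suc n ⊎ n ≡ suc m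
∣m⊖n∣≡1⇒m≡1+n⊎n≡1+m zero          (suc zero)    _ = inj₂ refl
∣m⊖n∣≡1⇒m≡1+n⊎n≡1+m (suc zero)    zero          _ = inj₁ refl
∣m⊖n∣≡1⇒m≡1+n⊎n≡1+m (suc m)       (suc n)       d = Sum.map (cong suc) (cong suc)
  (∣m⊖n∣≡1⇒m≡1+n⊎n≡1+m m n (trans (cong ∣_∣ (sym (ℤ.[1+m]⊖[1+n]≡m⊖n m n))) d))
∣m⊖n∣≡1⇒m≡1+n⊎n≡1+m zero          zero          ()
∣m⊖n∣≡1⇒m≡1+n⊎n≡1+m zero          (suc (suc n)) ()
∣m⊖n∣≡1⇒m≡1+n⊎n≡1+m (suc (suc m)) zero          ()

∣m-n∣≡1⇒m≡1+n⊎n≡1+m : ∀ m n → ∣ + m ℤ.- + n ∣ ≡ 1 → m ≡ suc n ⊎ n ≡ suc m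
∣m-n∣≡1⇒m≡1+n⊎n≡1+m m n d = ∣m⊖n∣≡1⇒m≡1+n⊎n≡1+m m n (trans (cong ∣_∣ (sym (ℤ.m-n≡m⊖n m n))) d)

adj⇒neighbours : ∀ {a b a' b'} → Adj (+ a , + b) (+ a' , + b') →
  (a ≡ a' × (b ≡ suc b' ⊎ b' ≡ suc b)) ⊎ (b ≡ b' × (a ≡ suc a' ⊎ a' ≡ suc a))
adj⇒neighbours {a} {b} {a'} {b'} (inj₁ (a≡a' , d)) =
  inj₁ (ℤ.+-injective a≡a' , ∣m-n∣≡1⇒m≡1+n⊎n≡1+m b b' d)
adj⇒neighbours {a} {b} {a'} {b'} (inj₂ (b≡b' , d)) =
  inj₂ (ℤ.+-injective b≡b' , ∣m-n∣≡1⇒m≡1+n⊎n≡1+m a a' d)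

m+p≤o+n⇒m-n≤o-p : ∀ m n o p → m + p ≤ o + n → + m ℤ.- + n ℤ.≤ + o ℤ.- + p
m+p≤o+n⇒m-n≤o-p m n o p m+p≤o+n =
  subst₂ ℤ._≤_ (cancelʳ (+ m) (+ n) (+ p)) (cancelˡ (+ o) (+ n) (+ p))
    (ℤ.+-monoˡ-≤ (ℤ.- (+ n ℤ.+ + p)) (+≤+ m+p≤o+n))
  where
  cancelʳ : ∀ x y z → (x ℤ.+ z) ℤ.- (y ℤ.+ z) ≡ x ℤ.- y
  cancelʳ = ℤ-Solver.solve-∀
  cancelˡ : ∀ x y z → (x ℤ.+ y) ℤ.- (y ℤ.+ z) ≡ x ℤ.- z
  cancelˡ = ℤ-Solver.solve-∀

+m≤+n-1⇒m<n : ∀ {m} n → + m ℤ.≤ + n ℤ.- + 1 → m < n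
+m≤+n-1⇒m<n (suc n) (+≤+ m≤n) = s≤s m≤n

m<n⇒+m≤+n-1 : ∀ {m n} → m < n → + m ℤ.≤ + n ℤ.- + 1
m<n⇒+m≤+n-1 (s≤s m≤n) = +≤+ m≤n

Row : ℕ → Set
Row a = 1 ≤ a × a ≤ 4

data Strip : VSet where
  cell : ∀ {a b} → Row a → 1 ≤ b → Strip (+ a , + b)

data Left (c : ℕ) : VSet where
  left : ∀ {a b} → b < c + a → Left c (+ a , + b)

data Stair (c : ℕ) : VSet where
  stair : ∀ {a} → Row a → Stair c (+ a , + (c + a))

data Right (c : ℕ) : VSet where
  right : ∀ {a b} → c + a < b → Right c (+ a , + b)

bounds⇒Strip : ∀ {i j} → + 1 ℤ.≤ i → i ℤ.≤ + 4 → + 1 ℤ.≤ j → Strip (i , j)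
bounds⇒Strip {+ a} {+ b} (+≤+ 1≤a) (+≤+ a≤4) (+≤+ 1≤b) = cell (1≤a , a≤4) 1≤b

Strip-split : ∀ c → Strip ⊆ Left c ∪ (Stair c ∪ Right c)
Strip-split c (cell {a} {b} row _) with <-cmp b (c + a)
... | tri< b<c+a _ _ = inj₁ (left b<c+a)
... | tri≈ _ refl _  = inj₂ (inj₁ (stair row))
... | tri> _ _ c+a<b = inj₂ (inj₂ (right c+a<b))

-- The diagonal coordinate j - i is below c on the left, above c on the right, and changes by 1 along an edge.
Left-Right-apart : ∀ c {u v} → Left c u → Right c v → ¬ Adj u v
Left-Right-apart c (left {a} {b} b<c+a) (right {a'} {b'} c+a'<b') u~v with adj⇒neighbours u~v
... | inj₁ (refl , inj₁ refl) = <⇒≱ b<c+a (≤-trans (<⇒≤ c+a'<b') (n≤1+n b'))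
... | inj₁ (refl , inj₂ refl) = <⇒≱ b<c+a (≤-pred c+a'<b')
... | inj₂ (refl , inj₁ refl) = <⇒≱ b<c+a (subst (_≤ b) (sym (+-suc c a')) c+a'<b')
... | inj₂ (refl , inj₂ refl) = <⇒≱ b<c+a (≤-trans (+-monoʳ-≤ c (n≤1+n a)) (<⇒≤ c+a'<b'))

Strip∩Left⊆Q : ∀ c → Strip ∩ Left c ⊆ Q c
Strip∩Left⊆Q c (cell (1≤a , a≤4) 1≤b , left b<c+a) =
  (+≤+ 1≤a , +≤+ a≤4) , (+≤+ 1≤b , m<n⇒+m≤+n-1 b<c+a)

stairLabel : ℕ → ℕ → (Vertex → ℕ) → (Vertex → ℕ) → Vertex → ℕ
stairLabel c μ g h (+ a , + b) with <-cmp b (c + a)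
... | tri< _ _ _ = g (+ a , + b)
... | tri≈ _ _ _ = μ + a
... | tri> _ _ _ = h (+ a , + b)
stairLabel c μ g h _ = 0

module _ (c μ : ℕ) (g h : Vertex → ℕ) where

  stairLabel-left : ∀ {v} → Left c v → stairLabel c μ g h v ≡ g v
  stairLabel-left (left {a} {b} b<c+a) with <-cmp b (c + a)
  ... | tri< _ _ _   = refl
  ... | tri≈ ¬lt _ _ = ⊥-elim (¬lt b<c+a)
  ... | tri> ¬lt _ _ = ⊥-elim (¬lt b<c+a)

  stairLabel-right : ∀ {v} → Right c v → stairLabel c μ g h v ≡ h v
  stairLabel-right (right {a} {b} c+a<b) with <-cmp b (c + a)
  ... | tri< _ _ ¬gt = ⊥-elim (¬gt c+a<b)
  ... | tri≈ _ _ ¬gt = ⊥-elim (¬gt c+a<b)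
  ... | tri> _ _ _   = refl

  stairLabel-stair : ∀ a → stairLabel c μ g h (+ a , + (c + a)) ≡ μ + a
  stairLabel-stair a with <-cmp (c + a) (c + a)
  ... | tri< _ ¬eq _ = ⊥-elim (¬eq refl)
  ... | tri≈ _ _ _   = refl
  ... | tri> _ ¬eq _ = ⊥-elim (¬eq refl)

  stairLabel-stair-bounds : ∀ {v} → Stair c v →
    μ < stairLabel c μ g h v × stairLabel c μ g h v ≤ μ + 4
  stairLabel-stair-bounds (stair {a} (1≤a , a≤4)) rewrite stairLabel-stair a =
    m<m+n μ 1≤a , +-monoʳ-≤ μ a≤4

  stairLabel-stair-injective : ∀ {u v} → Stair c u → Stair c v →
    stairLabel c μ g h u ≡ stairLabel c μ g h v → u ≡ v
  stairLabel-stair-injective (stair {a} _) (stair {a'} _) eq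
    rewrite stairLabel-stair a | stairLabel-stair a' with +-cancelˡ-≡ μ a a' eq
  ... | refl = refl

stair-ranking : ∀ {G H : VSet} {g h : Vertex → ℕ} {μ : ℕ} c (φ : GridEmbedding) →
  G ⊆ Strip → G ∩ Right c ⊆ H ∘ to φ → IsRanking (Q c) μ g → IsRanking H μ h →
  IsRanking G (μ + 4) (stairLabel c μ g (h ∘ to φ))
stair-ranking {g = g} {h} {μ} c φ G⊆Strip G∩Right⊆H g-ranks h-ranks =
  separator-ranking (λ Gv → Strip-split c (G⊆Strip Gv)) (Left-Right-apart c)
    (isRanking-pullback identity-embedding (λ (Gv , Lv) → Strip∩Left⊆Q c (G⊆Strip Gv , Lv))
      (stairLabel-left c μ g (h ∘ to φ) ∘ proj₂) g-ranks)
    (isRanking-pullback φ G∩Right⊆H (stairLabel-right c μ g (h ∘ to φ) ∘ proj₂) h-ranks)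
    (stairLabel-stair-bounds c μ g (h ∘ to φ)) (stairLabel-stair-injective c μ g (h ∘ to φ))
    (m≤m+n μ 4)

Q⊆Strip : ∀ n → Q n ⊆ Strip
Q⊆Strip n ((1≤i , i≤4) , (1≤j , _)) = bounds⇒Strip 1≤i i≤4 1≤j

Grid⊆Strip : ∀ n → Grid 4 n ⊆ Strip
Grid⊆Strip n ((1≤i , i≤4) , (1≤j , _)) = bounds⇒Strip 1≤i i≤4 1≤j

Q∩Right⊆P∘shift : ∀ m →
  Q (2 * suc m + 3) ∩ Right (suc m) ⊆ P m ∘ to (shift-columns (+ (suc m + 4)))
Q∩Right⊆P∘shift m (((1≤i , i≤4) , (_ , j≤)) , right {a} {b} 1+m+a<b) =
  (1≤i , i≤4) ,
  m+p≤o+n⇒m-n≤o-p a 3 b (suc m + 4) lower ,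
  m+p≤o+n⇒m-n≤o-p b (suc m + 4) (m + a) 1 upper
  where
  open ≤-Reasoning

  lower : a + (suc m + 4) ≤ b + 3
  lower = begin
    a + (suc m + 4)     ≡⟨ ℕ-Solver.solve (a ∷ m ∷ []) ⟩
    suc (suc m + a) + 3 ≤⟨ +-monoˡ-≤ 3 1+m+a<b ⟩
    b + 3               ∎

  upper : b + 1 ≤ (m + a) + (suc m + 4)
  upper = begin
    b + 1                 ≡⟨ +-comm b 1 ⟩
    suc b                 ≤⟨ +m≤+n-1⇒m<n (2 * suc m + 3 + a) j≤ ⟩
    2 * suc m + 3 + a     ≡⟨ ℕ-Solver.solve (m ∷ a ∷ []) ⟩
    (m + a) + (suc m + 4) ∎

flip-row : ∀ {a} → Row a → Σ ℕ λ a' → + 5 ℤ.- + a ≡ + a' × a + a' ≡ 5 × Row a'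
flip-row {1} _ = 4 , refl , refl , s≤s z≤n , s≤s (s≤s (s≤s (s≤s z≤n)))
flip-row {2} _ = 3 , refl , refl , s≤s z≤n , s≤s (s≤s (s≤s z≤n))
flip-row {3} _ = 2 , refl , refl , s≤s z≤n , s≤s (s≤s z≤n)
flip-row {4} _ = 1 , refl , refl , s≤s z≤n , s≤s z≤n
flip-row {0} (() , _)
flip-row {suc (suc (suc (suc (suc _))))} (_ , s≤s (s≤s (s≤s (s≤s ()))))

Grid∩Right⊆Q∘half-turn : ∀ c →
  Grid 4 (2 * c + 4) ∩ Right c ⊆ Q c ∘ to (half-turn (+ 5) (+ (2 * c + 5)))
Grid∩Right⊆Q∘half-turn c (((+≤+ 1≤a , +≤+ a≤4) , (_ , +≤+ b≤2c+4)) , right {a} {b} c+a<b)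
  with flip-row (1≤a , a≤4)
... | a' , 5-a≡a' , a+a'≡5 , (1≤a' , a'≤4) rewrite 5-a≡a' =
  (+≤+ 1≤a' , +≤+ a'≤4) ,
  m+p≤o+n⇒m-n≤o-p 1 0 (2 * c + 5) b lower ,
  m+p≤o+n⇒m-n≤o-p (2 * c + 5) b (c + a') 1 upper
  where
  open ≤-Reasoning

  lower : 1 + b ≤ 2 * c + 5 + 0
  lower = begin
    1 + b           ≤⟨ s≤s b≤2c+4 ⟩
    1 + (2 * c + 4) ≡⟨ ℕ-Solver.solve (c ∷ []) ⟩
    2 * c + 5 + 0   ∎

  upper : 2 * c + 5 + 1 ≤ (c + a') + b
  upper = begin
    2 * c + 5 + 1          ≡⟨ ℕ-Solver.solve (c ∷ []) ⟩
    2 * c + 1 + 5          ≡⟨ cong (λ s → 2 * c + 1 + s) (sym a+a'≡5) ⟩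
    2 * c + 1 + (a + a')   ≡⟨ ℕ-Solver.solve (c ∷ a ∷ a' ∷ []) ⟩
    (c + a') + suc (c + a) ≤⟨ +-monoʳ-≤ (c + a') c+a<b ⟩
    (c + a') + b           ∎

Q-ranking-from-Q-P : ∀ {μ} m → HasRanking (Q (suc m)) μ → HasRanking (P m) μ →
  HasRanking (Q (2 * suc m + 3)) (μ + 4)
Q-ranking-from-Q-P {μ} m (g , g-ranks) (h , h-ranks) =
  stairLabel (suc m) μ g (h ∘ to φ) ,
  stair-ranking (suc m) φ (Q⊆Strip (2 * suc m + 3)) (Q∩Right⊆P∘shift m) g-ranks h-ranks
  where
  φ : GridEmbedding
  φ = shift-columns (+ (suc m + 4))

Grid-ranking-from-Q : ∀ {μ} c → HasRanking (Q c) μ → HasRanking (Grid 4 (2 * c + 4)) (μ + 4)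
Grid-ranking-from-Q {μ} c (g , g-ranks) =
  stairLabel c μ g (g ∘ to φ) ,
  stair-ranking c φ (Grid⊆Strip (2 * c + 4)) (Grid∩Right⊆Q∘half-turn c) g-ranks g-ranks
  where
  φ : GridEmbedding
  φ = half-turn (+ 5) (+ (2 * c + 5))

mainTheorem4 : (n λ' : ℕ) → 1 ≤ n → 1 ≤ λ' →
    HasRanking (Q n) λ' → HasRanking (P (n ∸ 1)) λ' →
    HasRanking (Q (2 * n + 3)) (λ' + 4) × HasRanking (Grid 4 (4 * n + 10)) (λ' + 8)
mainTheorem4 zero    _  ()
mainTheorem4 (suc m) λ' _ _ Q-ranked P-ranked = Q′-ranked , Grid-ranked
  where
  Q′-ranked : HasRanking (Q (2 * suc m + 3)) (λ' + 4)
  Q′-ranked = Q-ranking-from-Q-P m Q-ranked P-ranked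

  width : 2 * (2 * suc m + 3) + 4 ≡ 4 * suc m + 10
  width = ℕ-Solver.solve (m ∷ [])

  Grid-ranked : HasRanking (Grid 4 (4 * suc m + 10)) (λ' + 8)
  Grid-ranked = subst₂ (λ w k → HasRanking (Grid 4 w) k) width (+-assoc λ' 4 4)
    (Grid-ranking-from-Q (2 * suc m + 3) Q′-ranked)
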